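{- Let $\mathcal{C}$ be a category with finite limits, $(T,\eta,\mu)$ a monad and $\Sigma$ an endofunctor on $\mathcal{C}$, and $\delta^{\Sigma}\colon\Sigma T\to T\Sigma$ a distributive law of $\Sigma$ over $T$. Then there exists a distributive law $\delta^{\Sigma+}\colon\Sigma T_+\to T_+\Sigma$ such that $i_{\Sigma X}\circ\delta^{\Sigma+}_X=\delta^{\Sigma}_X\circ\Sigma i_X$ for all $X$.
   Context: A distributive law of a functor $F$ over a monad $S$ is a natural transformation $\delta\colon FS\to SF$ with $\delta\circ F\eta^S=\eta^SF$ and $\delta\circ F\mu^S=\mu^SF\circ S\delta\circ\delta S$. For each $X$, $i_X\colon T_+X\to TX$ is the equalizer of $\eta_1\circ!\colon TX\to T1$ and $T!\colon TX\to T1$ ($1$ terminal, $!$ the unique morphism to $1$); $T_+$ carries the (unique) monad structure making $i\colon T_+\to T$ a monad morphism (the affine part of $T$). -}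

module Defs where

open import Level using (Level; _⊔_) renaming (suc to lsuc)
open import Relation.Binary using (Rel; IsEquivalence)
open import Data.Product using (Σ; _×_; _,_)

record Category (o ℓ e : Level) : Set (lsuc (o ⊔ ℓ ⊔ e)) where
  infixr 9 _∘_
  infix 4 _≈_
  field
    Obj : Set o
    _⇒_ : Obj → Obj → Set ℓ
    _≈_ : ∀ {A B} → Rel (A ⇒ B) e
    id  : ∀ {A} → A ⇒ A
    _∘_ : ∀ {A B C} → B ⇒ C → A ⇒ B → A ⇒ C
    equiv     : ∀ {A B} → IsEquivalence (_≈_ {A} {B})
    ∘-resp-≈  : ∀ {A B C} {f h : B ⇒ C} {g i : A ⇒ B} → f ≈ h → g ≈ i → f ∘ g ≈ h ∘ i
    identityˡ : ∀ {A B} {f : A ⇒ B} → id ∘ f ≈ f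
    identityʳ : ∀ {A B} {f : A ⇒ B} → f ∘ id ≈ f
    assoc     : ∀ {A B C D} {f : A ⇒ B} {g : B ⇒ C} {h : C ⇒ D} →
                (h ∘ g) ∘ f ≈ h ∘ (g ∘ f)

module _ {o ℓ e} (C : Category o ℓ e) where
  open Category C

  record Terminal : Set (o ⊔ ℓ ⊔ e) where
    field
      ⊤        : Obj
      !        : ∀ {A} → A ⇒ ⊤
      !-unique : ∀ {A} (f : A ⇒ ⊤) → ! ≈ f

  record BinaryProduct (A B : Obj) : Set (o ⊔ ℓ ⊔ e) where
    field
      A×B   : Obj
      π₁    : A×B ⇒ A
      π₂    : A×B ⇒ B
      ⟨_,_⟩ : ∀ {X} → X ⇒ A → X ⇒ B → X ⇒ A×B
      project₁ : ∀ {X} {f : X ⇒ A} {g : X ⇒ B} → π₁ ∘ ⟨ f , g ⟩ ≈ f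
      project₂ : ∀ {X} {f : X ⇒ A} {g : X ⇒ B} → π₂ ∘ ⟨ f , g ⟩ ≈ g
      unique   : ∀ {X} {h : X ⇒ A×B} {f : X ⇒ A} {g : X ⇒ B} →
                 π₁ ∘ h ≈ f → π₂ ∘ h ≈ g → ⟨ f , g ⟩ ≈ h

  record IsEqualizer {E A B : Obj} (eq : E ⇒ A) (f g : A ⇒ B) : Set (o ⊔ ℓ ⊔ e) where
    field
      equality  : f ∘ eq ≈ g ∘ eq
      factor    : ∀ {X} (h : X ⇒ A) → f ∘ h ≈ g ∘ h → X ⇒ E
      factor-eq : ∀ {X} (h : X ⇒ A) (p : f ∘ h ≈ g ∘ h) → eq ∘ factor h p ≈ h
      unique    : ∀ {X} (h : X ⇒ A) (p : f ∘ h ≈ g ∘ h) (k : X ⇒ E) →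
                  eq ∘ k ≈ h → k ≈ factor h p

  record Equalizer {A B : Obj} (f g : A ⇒ B) : Set (o ⊔ ℓ ⊔ e) where
    field
      obj   : Obj
      arr   : obj ⇒ A
      isEqualizer : IsEqualizer arr f g

  record FiniteLimits : Set (o ⊔ ℓ ⊔ e) where
    field
      terminal  : Terminal
      products  : ∀ A B → BinaryProduct A B
      equalizer : ∀ {A B} (f g : A ⇒ B) → Equalizer f g

  record Endofunctor : Set (o ⊔ ℓ ⊔ e) where
    field
      F₀ : Obj → Obj
      F₁ : ∀ {A B} → A ⇒ B → F₀ A ⇒ F₀ B
      identity     : ∀ {A} → F₁ (id {A}) ≈ id
      homomorphism : ∀ {A B C} {f : A ⇒ B} {g : B ⇒ C} → F₁ (g ∘ f) ≈ F₁ g ∘ F₁ f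
      F-resp-≈     : ∀ {A B} {f g : A ⇒ B} → f ≈ g → F₁ f ≈ F₁ g

  record Monad : Set (o ⊔ ℓ ⊔ e) where
    field
      F : Endofunctor
    open Endofunctor F public
    field
      η : ∀ X → X ⇒ F₀ X
      μ : ∀ X → F₀ (F₀ X) ⇒ F₀ X
      η-natural : ∀ {X Y} (f : X ⇒ Y) → η Y ∘ f ≈ F₁ f ∘ η X
      μ-natural : ∀ {X Y} (f : X ⇒ Y) → μ Y ∘ F₁ (F₁ f) ≈ F₁ f ∘ μ X
      assocμ    : ∀ {X} → μ X ∘ F₁ (μ X) ≈ μ X ∘ μ (F₀ X)
      identityˡ : ∀ {X} → μ X ∘ F₁ (η X) ≈ id
      identityʳ : ∀ {X} → μ X ∘ η (F₀ X) ≈ id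

  record MonadMorphism (S T : Monad) : Set (o ⊔ ℓ ⊔ e) where
    private
      module S = Monad S
      module T = Monad T
    field
      α : ∀ X → S.F₀ X ⇒ T.F₀ X
      natural : ∀ {X Y} (f : X ⇒ Y) → α Y ∘ S.F₁ f ≈ T.F₁ f ∘ α X
      unit    : ∀ {X} → α X ∘ S.η X ≈ T.η X
      mult    : ∀ {X} → α X ∘ S.μ X ≈ T.μ X ∘ (T.F₁ (α X) ∘ α (S.F₀ X))

  record DistributiveLaw (F : Endofunctor) (S : Monad) : Set (o ⊔ ℓ ⊔ e) where
    private
      module F = Endofunctor F
      module S = Monad S
    field
      δ : ∀ X → F.F₀ (S.F₀ X) ⇒ S.F₀ (F.F₀ X)
      natural : ∀ {X Y} (f : X ⇒ Y) → δ Y ∘ F.F₁ (S.F₁ f) ≈ S.F₁ (F.F₁ f) ∘ δ X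
      unit    : ∀ {X} → δ X ∘ F.F₁ (S.η X) ≈ S.η (F.F₀ X)
      mult    : ∀ {X} → δ X ∘ F.F₁ (S.μ X) ≈
                        S.μ (F.F₀ X) ∘ (S.F₁ (δ X) ∘ δ (S.F₀ X))

  IsAffinePart : FiniteLimits → (T T₊ : Monad) → MonadMorphism T₊ T → Set (o ⊔ ℓ ⊔ e)
  IsAffinePart lim T T₊ i =
    ∀ X → IsEqualizer (MonadMorphism.α i X)
                      (Monad.η T ⊤ ∘ ! {Monad.F₀ T X})
                      (Monad.F₁ T (! {X}))
    where open Terminal (FiniteLimits.terminal lim)

{-# OPTIONS --safe #-}
module Submission where

-- Equalizers are monic, so any δ₊ with i ∘ δ₊ = δ ∘ S i inherits the axioms of a
-- distributive law from δ: after composing with i, each axiom for δ₊ is obtained by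
-- pasting the corresponding axiom for δ with the monad-morphism squares of i.  Such a
-- δ₊ exists because δ ∘ S i factors through the equalizer i: by naturality of δ at !
-- and its unit law, whenever T ! ∘ g = η₁ ∘ ! we get
--   T ! ∘ δ ∘ S g = T ! ∘ δ₁ ∘ S (T ! ∘ g) = T ! ∘ δ₁ ∘ S (η₁ ∘ ! ∘ g) = η₁ ∘ !.

open import Level using (_⊔_)
open import Defs
open import Data.Product using (Σ; _,_)
open import Relation.Binary.Bundles using (Setoid)
import Relation.Binary.Reasoning.Setoid as SetoidReasoning

module _ {o ℓ e} (C : Category o ℓ e) where
  open Category C

  hom-setoid : Obj → Obj → Setoid ℓ e
  hom-setoid A B = record { Carrier = A ⇒ B ; _≈_ = _≈_ ; isEquivalence = equiv }

  module HomReasoning {A B : Obj} where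
    open SetoidReasoning (hom-setoid A B) public
    open Setoid (hom-setoid A B) public using () renaming (refl to ≈-refl; sym to ≈-sym; trans to ≈-trans)

  open HomReasoning

  infixr 4 _⟩∘⟨_ refl⟩∘⟨_
  infixl 5 _⟩∘⟨refl

  _⟩∘⟨_ : ∀ {A B D} {f h : B ⇒ D} {g k : A ⇒ B} → f ≈ h → g ≈ k → f ∘ g ≈ h ∘ k
  _⟩∘⟨_ = ∘-resp-≈

  refl⟩∘⟨_ : ∀ {A B D} {f : B ⇒ D} {g k : A ⇒ B} → g ≈ k → f ∘ g ≈ f ∘ k
  refl⟩∘⟨ p = ≈-refl ⟩∘⟨ p

  _⟩∘⟨refl : ∀ {A B D} {f h : B ⇒ D} {g : A ⇒ B} → f ≈ h → f ∘ g ≈ h ∘ g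
  p ⟩∘⟨refl = p ⟩∘⟨ ≈-refl

  pullˡ : ∀ {A B D E} {a : D ⇒ E} {b : B ⇒ D} {c : B ⇒ E} {f : A ⇒ B} →
          a ∘ b ≈ c → a ∘ (b ∘ f) ≈ c ∘ f
  pullˡ {a = a} {b} {c} {f} p = begin
    a ∘ (b ∘ f)  ≈⟨ assoc ⟨
    (a ∘ b) ∘ f  ≈⟨ p ⟩∘⟨refl ⟩
    c ∘ f        ∎

  pushˡ : ∀ {A B D E} {a : D ⇒ E} {b : B ⇒ D} {c : B ⇒ E} {f : A ⇒ B} →
          c ≈ a ∘ b → c ∘ f ≈ a ∘ (b ∘ f)
  pushˡ p = ≈-sym (pullˡ (≈-sym p))

  extendʳ : ∀ {A B B′ D E} {a : B ⇒ E} {b : D ⇒ B} {c : B′ ⇒ E} {d : D ⇒ B′} {f : A ⇒ D} →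
            a ∘ b ≈ c ∘ d → a ∘ (b ∘ f) ≈ c ∘ (d ∘ f)
  extendʳ p = ≈-trans (pullˡ p) assoc

  Monic : ∀ {A B} → A ⇒ B → Set (o ⊔ ℓ ⊔ e)
  Monic {A} m = ∀ {X} (f g : X ⇒ A) → m ∘ f ≈ m ∘ g → f ≈ g

  IsEqualizer⇒Monic : ∀ {E A B} {eq : E ⇒ A} {f g : A ⇒ B} → IsEqualizer C eq f g → Monic eq
  IsEqualizer⇒Monic {eq = eq} {f} {g} eqz h k p = begin
    h                  ≈⟨ unique (eq ∘ k) eq∘k-equalizes h p ⟩
    factor (eq ∘ k) _  ≈⟨ unique (eq ∘ k) eq∘k-equalizes k ≈-refl ⟨
    k                  ∎
    where
    open IsEqualizer eqz
    eq∘k-equalizes : f ∘ (eq ∘ k) ≈ g ∘ (eq ∘ k)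
    eq∘k-equalizes = extendʳ equality

  module _ (F : Endofunctor C) where
    open Endofunctor F

    [_]-resp-∘ : ∀ {A B D} {f : A ⇒ B} {g : B ⇒ D} {h : A ⇒ D} → g ∘ f ≈ h → F₁ g ∘ F₁ f ≈ F₁ h
    [_]-resp-∘ p = ≈-trans (≈-sym homomorphism) (F-resp-≈ p)

    [_]-resp-square : ∀ {A B B′ D} {f : A ⇒ B} {g : B ⇒ D} {h : A ⇒ B′} {k : B′ ⇒ D} →
                      g ∘ f ≈ k ∘ h → F₁ g ∘ F₁ f ≈ F₁ k ∘ F₁ h
    [_]-resp-square p = ≈-trans ([_]-resp-∘ p) homomorphism

  module LiftAlongMonic {S : Endofunctor C} {P T : Monad C} (i : MonadMorphism C P T)
    (i-monic : ∀ X → Monic (MonadMorphism.α i X)) (δ : DistributiveLaw C S T)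
    (δ₊ : ∀ X → Endofunctor.F₀ S (Monad.F₀ P X) ⇒ Monad.F₀ P (Endofunctor.F₀ S X))
    (δ₊-lifts-δ : ∀ X → MonadMorphism.α i (Endofunctor.F₀ S X) ∘ δ₊ X ≈
                    DistributiveLaw.δ δ X ∘ Endofunctor.F₁ S (MonadMorphism.α i X)) where
    private
      module S = Endofunctor S
      module P = Monad P
      module T = Monad T
      module D = DistributiveLaw δ
      module I = MonadMorphism i
    open I using (α)

    natural : ∀ {X Y} (f : X ⇒ Y) → δ₊ Y ∘ S.F₁ (P.F₁ f) ≈ P.F₁ (S.F₁ f) ∘ δ₊ X
    natural {X} {Y} f = i-monic (S.F₀ Y) _ _ (begin
      α (S.F₀ Y) ∘ (δ₊ Y ∘ S.F₁ (P.F₁ f))   ≈⟨ extendʳ (δ₊-lifts-δ Y) ⟩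
      D.δ Y ∘ (S.F₁ (α Y) ∘ S.F₁ (P.F₁ f))  ≈⟨ refl⟩∘⟨ [ S ]-resp-square (I.natural f) ⟩
      D.δ Y ∘ (S.F₁ (T.F₁ f) ∘ S.F₁ (α X))  ≈⟨ extendʳ (D.natural f) ⟩
      T.F₁ (S.F₁ f) ∘ (D.δ X ∘ S.F₁ (α X))  ≈⟨ refl⟩∘⟨ δ₊-lifts-δ X ⟨
      T.F₁ (S.F₁ f) ∘ (α (S.F₀ X) ∘ δ₊ X)   ≈⟨ extendʳ (I.natural (S.F₁ f)) ⟨
      α (S.F₀ Y) ∘ (P.F₁ (S.F₁ f) ∘ δ₊ X)   ∎)

    unit : ∀ {X} → δ₊ X ∘ S.F₁ (P.η X) ≈ P.η (S.F₀ X)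
    unit {X} = i-monic (S.F₀ X) _ _ (begin
      α (S.F₀ X) ∘ (δ₊ X ∘ S.F₁ (P.η X))   ≈⟨ extendʳ (δ₊-lifts-δ X) ⟩
      D.δ X ∘ (S.F₁ (α X) ∘ S.F₁ (P.η X))  ≈⟨ refl⟩∘⟨ [ S ]-resp-∘ I.unit ⟩
      D.δ X ∘ S.F₁ (T.η X)                  ≈⟨ D.unit ⟩
      T.η (S.F₀ X)                          ≈⟨ I.unit ⟨
      α (S.F₀ X) ∘ P.η (S.F₀ X)             ∎)

    α² : ∀ X → P.F₀ (P.F₀ X) ⇒ T.F₀ (T.F₀ X)
    α² X = T.F₁ (α X) ∘ α (P.F₀ X)

    δ² : ∀ X → S.F₀ (T.F₀ (T.F₀ X)) ⇒ T.F₀ (T.F₀ (S.F₀ X))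
    δ² X = T.F₁ (D.δ X) ∘ D.δ (T.F₀ X)

    δ₊² : ∀ X → S.F₀ (P.F₀ (P.F₀ X)) ⇒ P.F₀ (P.F₀ (S.F₀ X))
    δ₊² X = P.F₁ (δ₊ X) ∘ δ₊ (P.F₀ X)

    δ₊²-lifts-δ² : ∀ X → α² (S.F₀ X) ∘ δ₊² X ≈ δ² X ∘ S.F₁ (α² X)
    δ₊²-lifts-δ² X = begin
      (T.F₁ (α SX) ∘ α (P.F₀ SX)) ∘ (P.F₁ (δ₊ X) ∘ δ₊ PX)
        ≈⟨ assoc ⟩
      T.F₁ (α SX) ∘ (α (P.F₀ SX) ∘ (P.F₁ (δ₊ X) ∘ δ₊ PX))
        ≈⟨ refl⟩∘⟨ extendʳ (I.natural (δ₊ X)) ⟩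
      T.F₁ (α SX) ∘ (T.F₁ (δ₊ X) ∘ (α (S.F₀ PX) ∘ δ₊ PX))
        ≈⟨ refl⟩∘⟨ refl⟩∘⟨ δ₊-lifts-δ PX ⟩
      T.F₁ (α SX) ∘ (T.F₁ (δ₊ X) ∘ (D.δ PX ∘ S.F₁ (α PX)))
        ≈⟨ pullˡ ([ T.F ]-resp-∘ (δ₊-lifts-δ X)) ⟩
      T.F₁ (D.δ X ∘ S.F₁ (α X)) ∘ (D.δ PX ∘ S.F₁ (α PX))
        ≈⟨ pushˡ T.homomorphism ⟩
      T.F₁ (D.δ X) ∘ (T.F₁ (S.F₁ (α X)) ∘ (D.δ PX ∘ S.F₁ (α PX)))
        ≈⟨ refl⟩∘⟨ extendʳ (D.natural (α X)) ⟨
      T.F₁ (D.δ X) ∘ (D.δ (T.F₀ X) ∘ (S.F₁ (T.F₁ (α X)) ∘ S.F₁ (α PX)))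
        ≈⟨ refl⟩∘⟨ refl⟩∘⟨ S.homomorphism ⟨
      T.F₁ (D.δ X) ∘ (D.δ (T.F₀ X) ∘ S.F₁ (α² X))
        ≈⟨ assoc ⟨
      δ² X ∘ S.F₁ (α² X)
        ∎
      where
      SX PX : Obj
      SX = S.F₀ X
      PX = P.F₀ X

    mult : ∀ {X} → δ₊ X ∘ S.F₁ (P.μ X) ≈ P.μ (S.F₀ X) ∘ δ₊² X
    mult {X} = i-monic (S.F₀ X) _ _ (begin
      α (S.F₀ X) ∘ (δ₊ X ∘ S.F₁ (P.μ X))    ≈⟨ extendʳ (δ₊-lifts-δ X) ⟩
      D.δ X ∘ (S.F₁ (α X) ∘ S.F₁ (P.μ X))    ≈⟨ refl⟩∘⟨ [ S ]-resp-square I.mult ⟩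
      D.δ X ∘ (S.F₁ (T.μ X) ∘ S.F₁ (α² X))   ≈⟨ pullˡ D.mult ⟩
      (T.μ (S.F₀ X) ∘ δ² X) ∘ S.F₁ (α² X)    ≈⟨ assoc ⟩
      T.μ (S.F₀ X) ∘ (δ² X ∘ S.F₁ (α² X))    ≈⟨ refl⟩∘⟨ δ₊²-lifts-δ² X ⟨
      T.μ (S.F₀ X) ∘ (α² (S.F₀ X) ∘ δ₊² X)   ≈⟨ extendʳ I.mult ⟨
      α (S.F₀ X) ∘ (P.μ (S.F₀ X) ∘ δ₊² X)    ∎)

    distributiveLaw : DistributiveLaw C S P
    distributiveLaw = record { δ = δ₊ ; natural = natural ; unit = unit ; mult = mult }

  module _ (terminal : Terminal C) (T : Monad C) where
    open Terminal terminal
    private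
      module T = Monad T

    Affine : ∀ {A X} → A ⇒ T.F₀ X → Set e
    Affine g = (T.η ⊤ ∘ !) ∘ g ≈ T.F₁ ! ∘ g

    !-absorbʳ : ∀ {A B} (h : A ⇒ B) → ! ∘ h ≈ !
    !-absorbʳ h = ≈-sym (!-unique (! ∘ h))

    δ-preserves-Affine : ∀ {S : Endofunctor C} (δ : DistributiveLaw C S T) {A X} {g : A ⇒ T.F₀ X} →
                         Affine g → Affine (DistributiveLaw.δ δ X ∘ Endofunctor.F₁ S g)
    δ-preserves-Affine {S} δ {X = X} {g} g-affine = begin
      (T.η ⊤ ∘ !) ∘ (D.δ X ∘ S.F₁ g)  ≈⟨ assoc ⟩
      T.η ⊤ ∘ (! ∘ (D.δ X ∘ S.F₁ g))  ≈⟨ refl⟩∘⟨ !-absorbʳ _ ⟩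
      T.η ⊤ ∘ !                       ≈⟨ T!∘δ∘Sg ⟨
      T.F₁ ! ∘ (D.δ X ∘ S.F₁ g)       ∎
      where
      module S = Endofunctor S
      module D = DistributiveLaw δ
      T!∘g : T.F₁ ! ∘ g ≈ T.η ⊤ ∘ (! ∘ g)
      T!∘g = ≈-trans (≈-sym g-affine) assoc
      T!∘δ∘Sg : T.F₁ ! ∘ (D.δ X ∘ S.F₁ g) ≈ T.η ⊤ ∘ !
      T!∘δ∘Sg = begin
        T.F₁ ! ∘ (D.δ X ∘ S.F₁ g)                         ≈⟨ T.F-resp-≈ (!-unique (! ∘ S.F₁ !)) ⟩∘⟨refl ⟩
        T.F₁ (! ∘ S.F₁ !) ∘ (D.δ X ∘ S.F₁ g)             ≈⟨ pushˡ T.homomorphism ⟩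
        T.F₁ ! ∘ (T.F₁ (S.F₁ !) ∘ (D.δ X ∘ S.F₁ g))       ≈⟨ refl⟩∘⟨ extendʳ (D.natural !) ⟨
        T.F₁ ! ∘ (D.δ ⊤ ∘ (S.F₁ (T.F₁ !) ∘ S.F₁ g))       ≈⟨ refl⟩∘⟨ refl⟩∘⟨ [ S ]-resp-square T!∘g ⟩
        T.F₁ ! ∘ (D.δ ⊤ ∘ (S.F₁ (T.η ⊤) ∘ S.F₁ (! ∘ g)))  ≈⟨ refl⟩∘⟨ pullˡ D.unit ⟩
        T.F₁ ! ∘ (T.η (S.F₀ ⊤) ∘ S.F₁ (! ∘ g))            ≈⟨ extendʳ (T.η-natural !) ⟨
        T.η ⊤ ∘ (! ∘ S.F₁ (! ∘ g))                        ≈⟨ refl⟩∘⟨ !-absorbʳ _ ⟩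
        T.η ⊤ ∘ !                                         ∎

proposition49 : ∀ {o ℓ e} (C : Category o ℓ e) (lim : FiniteLimits C)
                  (T : Monad C) (S : Endofunctor C) (δ : DistributiveLaw C S T)
                  (T₊ : Monad C) (i : MonadMorphism C T₊ T) →
                  IsAffinePart C lim T T₊ i →
                  Σ (DistributiveLaw C S T₊) (λ δ₊ → ∀ X →
                    Category._≈_ C
                      (Category._∘_ C (MonadMorphism.α i (Endofunctor.F₀ S X))
                                      (DistributiveLaw.δ δ₊ X))
                      (Category._∘_ C (DistributiveLaw.δ δ X)
                                      (Endofunctor.F₁ S (MonadMorphism.α i X))))
proposition49 C lim T S δ T₊ i i-equalizes =
  LiftAlongMonic.distributiveLaw C i (λ X → IsEqualizer⇒Monic C (i-equalizes X)) δ δ₊ δ₊-lifts-δ ,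
  δ₊-lifts-δ
  where
  open Category C
  open Endofunctor S using (F₀; F₁)
  open MonadMorphism i using (α)
  module i-Eq X = IsEqualizer (i-equalizes X)

  δ∘Sα-affine : ∀ X → Affine C (FiniteLimits.terminal lim) T (DistributiveLaw.δ δ X ∘ F₁ (α X))
  δ∘Sα-affine X = δ-preserves-Affine C (FiniteLimits.terminal lim) T δ (i-Eq.equality X)

  δ₊ : ∀ X → F₀ (Monad.F₀ T₊ X) ⇒ Monad.F₀ T₊ (F₀ X)
  δ₊ X = i-Eq.factor (F₀ X) _ (δ∘Sα-affine X)

  δ₊-lifts-δ : ∀ X → α (F₀ X) ∘ δ₊ X ≈ DistributiveLaw.δ δ X ∘ F₁ (α X)
  δ₊-lifts-δ X = i-Eq.factor-eq (F₀ X) _ (δ∘Sα-affine X)
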